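{- Let $p$ be a prime with $p \equiv 1 \pmod 3$. Then for all integers $a \geq 0$ and $b \geq 0$, \[ \binom{pa + \frac{2}{3}(p-1)}{pb + \frac{1}{3}(p-1)} \equiv \binom{a}{b}\binom{\frac{2}{3}(p-1)}{\frac{1}{3}(p-1)} \pmod{p^2}. \]
   Context: Binomial coefficients $\binom{n}{k}$ with $k > n \geq 0$ are $0$. -}

module Defs where

module Submission where

-- Let p = 3m+1 be prime.
-- For b > a both sides vanish, so let a = b + c.  Every factorial (p·j + t)!
-- with t < p splits as pʲ · j! · blocks · (A+1)⋯(A+t), A = p·j, where the
-- "blocks" are the runs of non-multiples of p below p·j (factorial-split).
-- Inserted into C(N,K)·K!·(N-K)! = N! this yields an exact identity
-- (binomial-blocks): C(pa+2m, pb+m) times a product of blocks and rising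
-- products equals C(a,b) times another such product.  Modulo p² these
-- products are computed by a first-order Taylor expansion of (A+1)⋯(A+t) in
-- A (rise-taylor); the derivative terms vanish mod p because the factors pair
-- up to sums divisible by p (pairing; this uses that m is even).  Each full
-- block is then ≡ (p-1)!, and both products reduce to one unit U, the right
-- one multiplied by C(2m,m).  Cancelling U (mod-cancel) proves the theorem.

open import Defs
open import Data.Nat using (ℕ; _+_; _*_; _^_)
open import Data.Nat.Primality using (Prime)
open import Data.Nat.Combinatorics using (_C_)
open import Data.Integer using (+_; _-_)
open import Data.Integer.Divisibility using (_∣_)
open import Relation.Binary.PropositionalEquality using (_≡_)

open import Level using (0ℓ)
open import Data.Empty using (⊥; ⊥-elim)
open import Data.Product using (_,_; ∃-syntax)
open import Data.Sum using (_⊎_; inj₁; inj₂)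
open import Relation.Nullary using (yes; no; contradiction)
open import Relation.Binary.Bundles using (Setoid)
open import Relation.Binary.PropositionalEquality
  using (refl; sym; trans; cong; cong₂; subst; subst₂; module ≡-Reasoning)

open import Data.Nat using (zero; suc; _∸_; _<_; _≤?_; z≤n; s≤s; _!; NonZero; nonTrivial⇒≢1)
open import Data.Nat.Properties
open import Data.Nat.Divisibility as ℕᵈ using (_∤_) renaming (_∣_ to _∣ₙ_)
open import Data.Nat.Primality using (euclidsLemma; prime⇒nonZero; prime⇒nonTrivial; prime⇒irreducible)
open import Data.Nat.Combinatorics using (nCk≡n!/k![n-k]!; k![n∸k]!∣n!; k>n⇒nCk≡0)
open import Data.Nat.DivMod using (_/_; m/n*n≡m)
open import Algebra.Properties.CommutativeSemigroup *-commutativeSemigroup using (x∙yz≈y∙xz)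
import Data.Nat.Tactic.RingSolver as ℕ-Solver

import Data.Integer as ℤ
import Data.Integer.Properties as ℤᵖ
import Data.Integer.Divisibility.Signed as ℤˢ
open import Data.Integer.Tactic.RingSolver using (solve-∀)

infix 4 _≡_[mod_]

-- Congruence of naturals modulo n, phrased through integer divisibility in
-- the form the main theorem uses.  The record wrapper keeps x, y and n
-- inferable from a proof.
record _≡_[mod_] (x y n : ℕ) : Set where
  constructor mod-intro
  field divides : + n ∣ (+ x - + y)
open _≡_[mod_] using (divides)

module _ {n : ℕ} where

  -- Signed divisibility has the ring-compatible lemmas; these convert to and fro.
  signed : ∀ {x y} → x ≡ y [mod n ] → + n ℤˢ.∣ (+ x - + y)
  signed (mod-intro n∣x-y) = ℤˢ.∣ᵤ⇒∣ n∣x-y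

  unsigned : ∀ {x y} → + n ℤˢ.∣ (+ x - + y) → x ≡ y [mod n ]
  unsigned n∣x-y = mod-intro (ℤˢ.∣⇒∣ᵤ n∣x-y)

  mod-refl : ∀ x → x ≡ x [mod n ]
  mod-refl x = mod-intro (subst (n ∣ₙ_) (cong ℤ.∣_∣ (sym (ℤᵖ.+-inverseʳ (+ x)))) (n ℕᵈ.∣0))

  mod-sym : ∀ {x y} → x ≡ y [mod n ] → y ≡ x [mod n ]
  mod-sym {x} {y} (mod-intro n∣x-y) = mod-intro (subst (n ∣ₙ_) (ℤᵖ.∣i-j∣≡∣j-i∣ (+ x) (+ y)) n∣x-y)

  mod-trans : ∀ {x y z} → x ≡ y [mod n ] → y ≡ z [mod n ] → x ≡ z [mod n ]
  mod-trans {x} {y} {z} xy yz =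
    unsigned (subst (+ n ℤˢ.∣_) (telescope (+ x) (+ y) (+ z)) (ℤˢ.∣m∣n⇒∣m+n (signed xy) (signed yz)))
    where
    telescope : ∀ a b c → (a - b) ℤ.+ (b - c) ≡ a - c
    telescope = solve-∀

  mod-setoid : Setoid 0ℓ 0ℓ
  mod-setoid = record
    { Carrier = ℕ ; _≈_ = _≡_[mod n ]
    ; isEquivalence = record { refl = mod-refl _ ; sym = mod-sym ; trans = mod-trans } }

  mod-* : ∀ {x x′ y y′} → x ≡ x′ [mod n ] → y ≡ y′ [mod n ] → x * y ≡ x′ * y′ [mod n ]
  mod-* {x} {x′} {y} {y′} xx yy =
    unsigned (subst (+ n ℤˢ.∣_) difference
      (ℤˢ.∣m∣n⇒∣m+n (ℤˢ.∣m⇒∣m*n (+ y) (signed xx)) (ℤˢ.∣n⇒∣m*n (+ x′) (signed yy))))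
    where
    split : ∀ a a′ b b′ → (a - a′) ℤ.* b ℤ.+ a′ ℤ.* (b - b′) ≡ a ℤ.* b - a′ ℤ.* b′
    split = solve-∀
    difference : (+ x - + x′) ℤ.* + y ℤ.+ + x′ ℤ.* (+ y - + y′) ≡ + (x * y) - + (x′ * y′)
    difference rewrite ℤᵖ.pos-* x y | ℤᵖ.pos-* x′ y′ = split (+ x) (+ x′) (+ y) (+ y′)

  mod-absorb : ∀ x {d} → n ∣ₙ d → x + d ≡ x [mod n ]
  mod-absorb x {d} n∣d = mod-intro (
    subst (n ∣ₙ_) (cong ℤ.∣_∣ (sym (trans (cong (_- + x) (ℤᵖ.pos-+ x d)) (cancel (+ x) (+ d))))) n∣d)
    where
    cancel : ∀ a b → (a ℤ.+ b) - a ≡ b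
    cancel = solve-∀

mod-weaken : ∀ {n n′ x y} → n ∣ₙ n′ → x ≡ y [mod n′ ] → x ≡ y [mod n ]
mod-weaken n∣n′ (mod-intro n′∣x-y) = mod-intro (ℕᵈ.∣-trans n∣n′ n′∣x-y)

prime²-cancel : ∀ {p u z} → Prime p → p ∤ u → p * p ∣ₙ u * z → p * p ∣ₙ z
prime²-cancel {p} {u} {z} p-prime p∤u p²∣uz
  with euclidsLemma u z p-prime (ℕᵈ.∣-trans (ℕᵈ.m∣m*n p) p²∣uz)
... | inj₁ p∣u = contradiction p∣u p∤u
... | inj₂ (ℕᵈ.divides q refl) = ℕᵈ.*-monoˡ-∣ p p∣q
  where
  instance _ = prime⇒nonZero p-prime
  p∣uq : p ∣ₙ u * q
  p∣uq = ℕᵈ.*-cancelʳ-∣ p (subst (p * p ∣ₙ_) (sym (*-assoc u q p)) p²∣uz)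
  p∣q : p ∣ₙ q
  p∣q with euclidsLemma u q p-prime p∣uq
  ... | inj₁ p∣u = contradiction p∣u p∤u
  ... | inj₂ p∣q = p∣q

mod-cancel : ∀ {p u x y} → Prime p → p ∤ u → u * x ≡ u * y [mod p * p ] → x ≡ y [mod p * p ]
mod-cancel {p} {u} {x} {y} p-prime p∤u (mod-intro p²∣ux-uy) =
  mod-intro (prime²-cancel p-prime p∤u (subst (p * p ∣ₙ_) absolute p²∣ux-uy))
  where
  factor : ∀ a b c → a ℤ.* b - a ℤ.* c ≡ a ℤ.* (b - c)
  factor = solve-∀
  absolute : ℤ.∣ + (u * x) - + (u * y) ∣ ≡ u * ℤ.∣ + x - + y ∣
  absolute = begin
    ℤ.∣ + (u * x) - + (u * y) ∣      ≡⟨ cong₂ (λ a b → ℤ.∣ a - b ∣) (ℤᵖ.pos-* u x) (ℤᵖ.pos-* u y) ⟩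
    ℤ.∣ + u ℤ.* + x - + u ℤ.* + y ∣  ≡⟨ cong ℤ.∣_∣ (factor (+ u) (+ x) (+ y)) ⟩
    ℤ.∣ + u ℤ.* (+ x - + y) ∣        ≡⟨ ℤᵖ.abs-* (+ u) (+ x - + y) ⟩
    u * ℤ.∣ + x - + y ∣              ∎
    where open ≡-Reasoning

module _ {p : ℕ} (p-prime : Prime p) where

  ∤-* : ∀ {x y} → p ∤ x → p ∤ y → p ∤ x * y
  ∤-* {x} {y} p∤x p∤y p∣xy with euclidsLemma x y p-prime p∣xy
  ... | inj₁ p∣x = p∤x p∣x
  ... | inj₂ p∣y = p∤y p∣y

  ∤-1 : p ∤ 1
  ∤-1 p∣1 = nonTrivial⇒≢1 {{prime⇒nonTrivial p-prime}} (ℕᵈ.∣1⇒≡1 p∣1)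

  ∤-^ : ∀ {x} → p ∤ x → ∀ k → p ∤ x ^ k
  ∤-^ p∤x zero    = ∤-1
  ∤-^ p∤x (suc k) = ∤-* p∤x (∤-^ p∤x k)

  ∤-! : ∀ t → t < p → p ∤ t !
  ∤-! zero    _   = ∤-1
  ∤-! (suc t) t<p = ∤-* (ℕᵈ.>⇒∤ t<p) (∤-! t (<-trans (n<1+n t) t<p))

  ∤-+-multiple : ∀ {x} y → p ∤ x → p ∤ x + p * y
  ∤-+-multiple {x} y p∤x p∣x+py = p∤x (ℕᵈ.∣m+n∣m⇒∣n (subst (p ∣ₙ_) (+-comm x (p * y)) p∣x+py) (ℕᵈ.m∣m*n y))

rise : ℕ → ℕ → ℕ
rise A zero    = 1
rise A (suc t) = rise A t * suc (A + t)

-- rise′ A t = Σᵢ Πⱼ≠ᵢ (A+j), the derivative of rise A t with respect to A;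
-- it is the first-order term when A is perturbed (see rise-taylor).
rise′ : ℕ → ℕ → ℕ
rise′ A zero    = 0
rise′ A (suc t) = rise′ A t * suc (A + t) + rise A t

factorial-rise : ∀ A t → (A + t) ! ≡ A ! * rise A t
factorial-rise A zero    = trans (cong _! (+-identityʳ A)) (sym (*-identityʳ (A !)))
factorial-rise A (suc t) = begin
  (A + suc t) !                  ≡⟨ cong _! (+-suc A t) ⟩
  suc (A + t) * (A + t) !        ≡⟨ cong (suc (A + t) *_) (factorial-rise A t) ⟩
  suc (A + t) * (A ! * rise A t) ≡⟨ reorder (A !) (rise A t) (suc (A + t)) ⟩
  A ! * (rise A t * suc (A + t)) ∎
  where
  open ≡-Reasoning
  reorder : ∀ a r s → s * (a * r) ≡ a * (r * s)
  reorder = ℕ-Solver.solve-∀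

rise-0 : ∀ t → rise 0 t ≡ t !
rise-0 t = trans (sym (+-identityʳ (rise 0 t))) (sym (factorial-rise 0 t))

rise-+ : ∀ A s t → rise A (s + t) ≡ rise A s * rise (A + s) t
rise-+ A s zero    = trans (cong (rise A) (+-identityʳ s)) (sym (*-identityʳ (rise A s)))
rise-+ A s (suc t) = begin
  rise A (s + suc t)                                 ≡⟨ cong (rise A) (+-suc s t) ⟩
  rise A (s + t) * suc (A + (s + t))                 ≡⟨ cong₂ (λ r u → r * suc u) (rise-+ A s t) (sym (+-assoc A s t)) ⟩
  rise A s * rise (A + s) t * suc (A + s + t)        ≡⟨ *-assoc (rise A s) _ _ ⟩
  rise A s * (rise (A + s) t * suc (A + s + t))      ∎
  where open ≡-Reasoning

rise′-+ : ∀ A s t → rise′ A (s + t) ≡ rise′ A s * rise (A + s) t + rise A s * rise′ (A + s) t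
rise′-+ A s zero = begin
  rise′ A (s + 0)                              ≡⟨ cong (rise′ A) (+-identityʳ s) ⟩
  rise′ A s                                    ≡⟨ pad (rise′ A s) (rise A s) ⟩
  rise′ A s * 1 + rise A s * 0                 ∎
  where
  open ≡-Reasoning
  pad : ∀ d r → d ≡ d * 1 + r * 0
  pad = ℕ-Solver.solve-∀
rise′-+ A s (suc t) = begin
  rise′ A (s + suc t)                                        ≡⟨ cong (rise′ A) (+-suc s t) ⟩
  rise′ A (s + t) * suc (A + (s + t)) + rise A (s + t)      ≡⟨ cong₂ (λ d u → d * suc u + rise A (s + t)) (rise′-+ A s t) (sym (+-assoc A s t)) ⟩
  (d₁ * r₂ + r₁ * d₂) * x + rise A (s + t)                   ≡⟨ cong (λ r → (d₁ * r₂ + r₁ * d₂) * x + r) (rise-+ A s t) ⟩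
  (d₁ * r₂ + r₁ * d₂) * x + r₁ * r₂                          ≡⟨ expand d₁ r₁ r₂ d₂ x ⟩
  d₁ * (r₂ * x) + r₁ * (d₂ * x + r₂)                         ∎
  where
  open ≡-Reasoning
  d₁ = rise′ A s
  r₁ = rise A s
  r₂ = rise (A + s) t
  d₂ = rise′ (A + s) t
  x  = suc (A + s + t)
  expand : ∀ d₁ r₁ r₂ d₂ x → (d₁ * r₂ + r₁ * d₂) * x + r₁ * r₂ ≡ d₁ * (r₂ * x) + r₁ * (d₂ * x + r₂)
  expand = ℕ-Solver.solve-∀

rise-taylor : ∀ A t → rise A t ≡ rise 0 t + A * rise′ 0 t [mod A * A ]
rise-taylor A zero rewrite *-zeroʳ A = mod-refl 1
rise-taylor A (suc t) = begin
  rise A t * suc (A + t)                       ≈⟨ mod-* (rise-taylor A t) (mod-refl (suc (A + t))) ⟩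
  (r + A * d) * suc (A + t)                    ≡⟨ expand r d A t ⟩
  (r * suc t + A * (d * suc t + r)) + A * A * d  ≈⟨ mod-absorb _ (ℕᵈ.m∣m*n d) ⟩
  r * suc t + A * (d * suc t + r)              ∎
  where
  open import Relation.Binary.Reasoning.Setoid (mod-setoid {A * A})
  r = rise 0 t
  d = rise′ 0 t
  expand : ∀ r d A t → (r + A * d) * suc (A + t) ≡ (r * suc t + A * (d * suc t + r)) + A * A * d
  expand = ℕ-Solver.solve-∀

rise-shift : ∀ p j t → rise (p * j) t ≡ t ! + p * j * rise′ 0 t [mod p * p ]
rise-shift p j t = subst (λ f → rise (p * j) t ≡ f + p * j * rise′ 0 t [mod p * p ]) (rise-0 t)
  (mod-weaken (ℕᵈ.*-pres-∣ (ℕᵈ.m∣m*n {p} j) (ℕᵈ.m∣m*n {p} j)) (rise-taylor (p * j) t))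

rise-peel : ∀ A t → rise A (suc t) ≡ suc A * rise (suc A) t
rise-peel A zero    = trans (cong (λ a → 1 * suc a) (+-identityʳ A)) (*-comm 1 (suc A))
rise-peel A (suc t) = begin
  rise A (suc t) * suc (A + suc t)          ≡⟨ cong₂ (λ r a → r * suc a) (rise-peel A t) (+-suc A t) ⟩
  suc A * rise (suc A) t * suc (suc A + t)  ≡⟨ *-assoc (suc A) (rise (suc A) t) (suc (suc A + t)) ⟩
  suc A * rise (suc A) (suc t)              ∎
  where open ≡-Reasoning

rise′-peel : ∀ A t → rise′ A (suc t) ≡ suc A * rise′ (suc A) t + rise (suc A) t
rise′-peel A zero rewrite *-zeroʳ A = refl
rise′-peel A (suc t) = begin
  rise′ A (suc t) * suc (A + suc t) + rise A (suc t)
    ≡⟨ cong₂ (λ d a → d * suc a + rise A (suc t)) (rise′-peel A t) (+-suc A t) ⟩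
  (a * d + r) * x + rise A (suc t)
    ≡⟨ cong (λ u → (a * d + r) * x + u) (rise-peel A t) ⟩
  (a * d + r) * x + a * r
    ≡⟨ expand a d r x ⟩
  a * (d * x + r) + r * x
    ∎
  where
  open ≡-Reasoning
  a = suc A
  d = rise′ (suc A) t
  r = rise (suc A) t
  x = suc (suc A + t)
  expand : ∀ a d r x → (a * d + r) * x + a * r ≡ a * (d * x + r) + r * x
  expand = ℕ-Solver.solve-∀

-- Pairing the factors A+i and A+t+1-i: when t is even and the outermost pair
-- sums to a multiple of p, every pair does, and rise′ A t ≡ 0 (mod p), since
-- rise′ A t = Σᵢ rise A t / (A+i) and the terms of each pair cancel.
pairing : ∀ {p} h A → p ∣ₙ suc A + (A + (h + h)) → p ∣ₙ rise′ A (h + h)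
pairing zero    A _ = _ ℕᵈ.∣0
pairing {p} (suc h) A p∣sum rewrite +-suc h h =
  subst (p ∣ₙ_) (sym regroup)
    (ℕᵈ.∣m∣n⇒∣m+n (ℕᵈ.∣n⇒∣m*n (suc A * x) (pairing h (suc A) (subst (p ∣ₙ_) (same-sum-inner A t) p∣sum)))
                  (ℕᵈ.∣n⇒∣m*n r (subst (p ∣ₙ_) (same-sum-outer A t) p∣sum)))
  where
  open ≡-Reasoning
  t = h + h
  d = rise′ (suc A) t
  r = rise (suc A) t
  x = suc (suc A + t)
  same-sum-inner : ∀ A t → suc A + (A + suc (suc t)) ≡ suc (suc A) + (suc A + t)
  same-sum-inner = ℕ-Solver.solve-∀
  same-sum-outer : ∀ A t → suc A + (A + suc (suc t)) ≡ suc A + suc (suc A + t)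
  same-sum-outer = ℕ-Solver.solve-∀
  regroup : rise′ A (suc (suc t)) ≡ suc A * x * d + r * (suc A + x)
  regroup = begin
    rise′ A (suc (suc t))                 ≡⟨ rise′-peel A (suc t) ⟩
    suc A * (d * x + r) + r * x           ≡⟨ expand (suc A) d r x ⟩
    suc A * x * d + r * (suc A + x)       ∎
    where
    expand : ∀ a d r x → a * (d * x + r) + r * x ≡ a * x * d + r * (a + x)
    expand = ℕ-Solver.solve-∀

-- blocks k a = Π_{j<a} rise (n·j) k for n = k+1: what remains of (n·a)!
-- after removing the multiples n, 2n, …, a·n.
blocks : ℕ → ℕ → ℕ
blocks k zero    = 1
blocks k (suc a) = rise (suc k * a) k * blocks k a

factorial-blocks : ∀ k a → (suc k * a) ! ≡ suc k ^ a * (a ! * blocks k a)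
factorial-blocks k zero rewrite *-zeroʳ k = refl
factorial-blocks k (suc a) = begin
  (n * suc a) !                                ≡⟨ cong _! (last-block k a) ⟩
  suc (n * a + k) * (n * a + k) !              ≡⟨ cong (suc (n * a + k) *_) (factorial-rise (n * a) k) ⟩
  suc (n * a + k) * ((n * a) ! * R)            ≡⟨ cong₂ (λ x y → x * (y * R)) (sym (last-block k a)) (factorial-blocks k a) ⟩
  n * suc a * (n ^ a * (a ! * B) * R)          ≡⟨ regroup n (suc a) (n ^ a) (a !) B R ⟩
  n * n ^ a * (suc a * a ! * (R * B))          ∎
  where
  open ≡-Reasoning
  n = suc k
  R = rise (n * a) k
  B = blocks k a
  last-block : ∀ k a → suc k * suc a ≡ suc (suc k * a + k)
  last-block = ℕ-Solver.solve-∀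
  regroup : ∀ n a′ x f B R → n * a′ * (x * (f * B) * R) ≡ n * x * (a′ * f * (R * B))
  regroup = ℕ-Solver.solve-∀

factorial-split : ∀ k j t → (suc k * j + t) ! ≡ suc k ^ j * (j ! * blocks k j) * rise (suc k * j) t
factorial-split k j t = trans (factorial-rise (suc k * j) t) (cong (_* rise (suc k * j) t) (factorial-blocks k j))

-- When p = k+1 divides rise′ 0 k, each block is ≡ k! (mod p²), so the
-- blocks contribute (k!)ᵃ.
blocks-mod : ∀ k → suc k ∣ₙ rise′ 0 k → ∀ a → blocks k a ≡ (k !) ^ a [mod suc k * suc k ]
blocks-mod k p∣d zero    = mod-refl 1
blocks-mod k p∣d (suc a) = mod-* block (blocks-mod k p∣d a)
  where
  block : rise (suc k * a) k ≡ k ! [mod suc k * suc k ]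
  block = mod-trans (rise-shift (suc k) a k)
                    (mod-absorb (k !) (ℕᵈ.*-pres-∣ (ℕᵈ.m∣m*n {suc k} a) p∣d))

binomial-factorials : ∀ i j → ((i + j) C i) * (i ! * j !) ≡ (i + j) !
binomial-factorials i j = begin
  ((i + j) C i) * (i ! * j !)                       ≡⟨ cong (λ x → ((i + j) C i) * (i ! * x !)) (sym (m+n∸m≡n i j)) ⟩
  ((i + j) C i) * (i ! * (i + j ∸ i) !)             ≡⟨ cong (_* (i ! * (i + j ∸ i) !)) (nCk≡n!/k![n-k]! i≤i+j) ⟩
  ((i + j) ! / (i ! * (i + j ∸ i) !)) * (i ! * (i + j ∸ i) !)  ≡⟨ m/n*n≡m (k![n∸k]!∣n! i≤i+j) ⟩
  (i + j) !                                         ∎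
  where
  open ≡-Reasoning
  instance _ = i !* (i + j ∸ i) !≢0
  i≤i+j = m≤m+n i j

rise-binomial : ∀ i j → rise i j ≡ ((i + j) C i) * j !
rise-binomial i j = *-cancelˡ-≡ (rise i j) (((i + j) C i) * j !) (i !) {{i !≢0}} (begin
  i ! * rise i j                 ≡⟨ sym (factorial-rise i j) ⟩
  (i + j) !                      ≡⟨ sym (binomial-factorials i j) ⟩
  ((i + j) C i) * (i ! * j !)    ≡⟨ x∙yz≈y∙xz ((i + j) C i) (i !) (j !) ⟩
  i ! * (((i + j) C i) * j !)    ∎)
  where open ≡-Reasoning

-- For n = k+1, splitting the factorials in C((nb+r)+(nc+s), nb+r) at the
-- multiples of n separates off C(b+c, b); what is left on either side are
-- blocks and rising products, whose residues are computed separately.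
binomial-blocks : ∀ k b c r s →
  let n = suc k in
  (((n * b + r) + (n * c + s)) C (n * b + r)) * (blocks k b * blocks k c * (rise (n * b) r * rise (n * c) s))
    ≡ ((b + c) C b) * (blocks k (b + c) * rise (n * (b + c)) (r + s))
binomial-blocks k b c r s = *-cancelˡ-≡ _ _ Q {{Q≢0}} (begin
  Q * (X * (Bb * Bc * (ub * uc)))
    ≡⟨ regroup-left (n ^ b) (n ^ c) (b !) (c !) X Bb Bc ub uc ⟩
  X * ((n ^ b * (b ! * Bb) * ub) * (n ^ c * (c ! * Bc) * uc))
    ≡⟨ cong (X *_) (sym (cong₂ _*_ (factorial-split k b r) (factorial-split k c s))) ⟩
  X * ((n * b + r) ! * (n * c + s) !)
    ≡⟨ binomial-factorials (n * b + r) (n * c + s) ⟩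
  ((n * b + r) + (n * c + s)) !
    ≡⟨ cong _! (interleave n b c r s) ⟩
  (n * (b + c) + (r + s)) !
    ≡⟨ factorial-split k (b + c) (r + s) ⟩
  n ^ (b + c) * ((b + c) ! * B) * w
    ≡⟨ cong₂ (λ x y → x * (y * B) * w) (^-distribˡ-+-* n b c) (sym (binomial-factorials b c)) ⟩
  n ^ b * n ^ c * (((b + c) C b) * (b ! * c !) * B) * w
    ≡⟨ regroup-right (n ^ b) (n ^ c) (b !) (c !) ((b + c) C b) B w ⟩
  Q * (((b + c) C b) * (B * w))
    ∎)
  where
  open ≡-Reasoning
  n  = suc k
  Q  = n ^ b * n ^ c * (b ! * c !)
  Q≢0 : NonZero Q
  Q≢0 = m*n≢0 _ _ {{m*n≢0 _ _ {{m^n≢0 n b}} {{m^n≢0 n c}}}} {{b !* c !≢0}}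
  X  = ((n * b + r) + (n * c + s)) C (n * b + r)
  Bb = blocks k b
  Bc = blocks k c
  ub = rise (n * b) r
  uc = rise (n * c) s
  B  = blocks k (b + c)
  w  = rise (n * (b + c)) (r + s)
  regroup-left : ∀ xb xc fb fc X Bb Bc ub uc →
    xb * xc * (fb * fc) * (X * (Bb * Bc * (ub * uc))) ≡ X * ((xb * (fb * Bb) * ub) * (xc * (fc * Bc) * uc))
  regroup-left = ℕ-Solver.solve-∀
  interleave : ∀ n b c r s → (n * b + r) + (n * c + s) ≡ n * (b + c) + (r + s)
  interleave = ℕ-Solver.solve-∀
  regroup-right : ∀ xb xc fb fc K B w →
    xb * xc * (K * (fb * fc) * B) * w ≡ xb * xc * (fb * fc) * (K * (B * w))
  regroup-right = ℕ-Solver.solve-∀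

halve : ∀ n → ∃[ h ] (n ≡ h + h ⊎ n ≡ suc (h + h))
halve zero    = 0 , inj₁ refl
halve (suc n) with halve n
... | h , inj₁ n≡2h  = h , inj₂ (cong suc n≡2h)
... | h , inj₂ n≡2h+1 = suc h , inj₁ (cong suc (trans n≡2h+1 (sym (+-suc h h))))

-- If 3m+1 is prime then m is even: for odd m, 3m+1 is an even number ≥ 4.
even-of-prime : ∀ m → Prime (suc (3 * m)) → ∃[ h ] m ≡ h + h
even-of-prime m p-prime with halve m
... | h , inj₁ m≡2h = h , m≡2h
... | h , inj₂ refl = ⊥-elim (refute (prime⇒irreducible p-prime (ℕᵈ.divides (3 * h + 2) (twice h))))
  where
  twice : ∀ h → suc (3 * suc (h + h)) ≡ (3 * h + 2) * 2
  twice = ℕ-Solver.solve-∀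
  four-plus : ∀ h → suc (3 * suc (h + h)) ≡ 4 + 6 * h
  four-plus = ℕ-Solver.solve-∀
  refute : 2 ≡ 1 ⊎ 2 ≡ suc (3 * suc (h + h)) → ⊥
  refute (inj₁ ())
  refute (inj₂ 2≡p) with trans 2≡p (four-plus h)
  ... | ()

module Corollary (m : ℕ) (p-prime : Prime (suc (3 * m))) where

  p : ℕ
  p = suc (3 * m)

  M W E B : ℕ
  M = m !              -- the tail 1⋯m of (pb+m)! modulo p
  W = (3 * m) !        -- (p-1)!, the residue of a full block
  E = rise′ 0 m        -- the first-order correction of M under a shift by p
  B = (m + m) C m

  -- The two pairing instances: 1…3m pair up to sums p, and so do m+1…2m.
  p∣rise′-full : p ∣ₙ rise′ 0 (3 * m)
  p∣rise′-full with even-of-prime m p-prime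
  ... | h , refl = subst (λ t → p ∣ₙ rise′ 0 t) (sym (triple h))
                     (pairing (3 * h) 0 (subst (p ∣ₙ_) (cong suc (triple h)) ℕᵈ.∣-refl))
    where
    triple : ∀ h → 3 * (h + h) ≡ 3 * h + 3 * h
    triple = ℕ-Solver.solve-∀

  p∣rise′-upper : p ∣ₙ rise′ m m
  p∣rise′-upper with even-of-prime m p-prime
  ... | h , refl = pairing h (h + h) (subst (p ∣ₙ_) (upper h) ℕᵈ.∣-refl)
    where
    upper : ∀ h → suc (3 * (h + h)) ≡ suc (h + h) + (h + h + (h + h))
    upper = ℕ-Solver.solve-∀

  -- The common unit U that both sides of the main identity reduce to mod p².
  G U : ℕ → ℕ
  G a = M * M + p * (a * (E * M))
  U a = W ^ a * G a

  p∤U : ∀ a → p ∤ U a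
  p∤U a = ∤-* p-prime (∤-^ p-prime p∤W a) (∤-+-multiple p-prime (a * (E * M)) (∤-* p-prime p∤M p∤M))
    where
    p∤W = ∤-! p-prime (3 * m) (n<1+n (3 * m))
    p∤M = ∤-! p-prime m (s≤s (m≤m+n m (2 * m)))

  lower-too-large : ∀ {a b} → a < b → p * a + 2 * m < p * b + m
  lower-too-large {a} {b} a<b = begin-strict
    p * a + 2 * m                <⟨ m<m+n (p * a + 2 * m) (s≤s (z≤n {2 * m})) ⟩
    p * a + 2 * m + suc (2 * m)  ≡⟨ next-multiple m a ⟩
    p * suc a + m                ≤⟨ +-monoˡ-≤ m (*-monoʳ-≤ p a<b) ⟩
    p * b + m                    ∎
    where
    open ≤-Reasoning
    next-multiple : ∀ m a → suc (3 * m) * a + 2 * m + suc (2 * m) ≡ suc (3 * m) * suc a + m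
    next-multiple = ℕ-Solver.solve-∀

  open import Relation.Binary.Reasoning.Setoid (mod-setoid {p * p})

  blocks≡W^ : ∀ a → blocks (3 * m) a ≡ W ^ a [mod p * p ]
  blocks≡W^ = blocks-mod (3 * m) p∣rise′-full

  -- Left side: the non-multiples of p in (pb+m)! and (pc+m)!.
  left≡U : ∀ b c → blocks (3 * m) b * blocks (3 * m) c * (rise (p * b) m * rise (p * c) m) ≡ U (b + c) [mod p * p ]
  left≡U b c = mod-* blocks-part rise-part
    where
    blocks-part : blocks (3 * m) b * blocks (3 * m) c ≡ W ^ (b + c) [mod p * p ]
    blocks-part = begin
      blocks (3 * m) b * blocks (3 * m) c  ≈⟨ mod-* (blocks≡W^ b) (blocks≡W^ c) ⟩
      W ^ b * W ^ c                        ≡⟨ sym (^-distribˡ-+-* W b c) ⟩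
      W ^ (b + c)                          ∎
    expand : ∀ p b c M E → (M + p * b * E) * (M + p * c * E) ≡ (M * M + p * ((b + c) * (E * M))) + p * p * (b * c * (E * E))
    expand = ℕ-Solver.solve-∀
    rise-part : rise (p * b) m * rise (p * c) m ≡ G (b + c) [mod p * p ]
    rise-part = begin
      rise (p * b) m * rise (p * c) m      ≈⟨ mod-* (rise-shift p b m) (rise-shift p c m) ⟩
      (M + p * b * E) * (M + p * c * E)    ≡⟨ expand p b c M E ⟩
      G (b + c) + p * p * (b * c * (E * E)) ≈⟨ mod-absorb (G (b + c)) (ℕᵈ.m∣m*n (b * c * (E * E))) ⟩
      G (b + c)                            ∎

  -- Right side: the non-multiples of p in (p(b+c)+2m)!; the upper half m+1…2m
  -- of the tail contributes the factor B.
  right≡BU : ∀ a → blocks (3 * m) a * rise (p * a) (m + m) ≡ B * U a [mod p * p ]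
  right≡BU a = begin
    blocks (3 * m) a * rise (p * a) (m + m)   ≈⟨ mod-* (blocks≡W^ a) tail ⟩
    W ^ a * (B * G a)                         ≡⟨ x∙yz≈y∙xz (W ^ a) B (G a) ⟩
    B * U a                                   ∎
    where
    expand : ∀ p a B M E R Z → B * (M * M) + p * a * (E * R + Z)
                             ≡ (B * (M * M) + p * a * (E * R)) + p * (a * Z)
    expand = ℕ-Solver.solve-∀
    factor : ∀ p a B M E → B * (M * M) + p * a * (E * (B * M)) ≡ B * (M * M + p * (a * (E * M)))
    factor = ℕ-Solver.solve-∀
    tail : rise (p * a) (m + m) ≡ B * G a [mod p * p ]
    tail = begin
      rise (p * a) (m + m)                                           ≈⟨ rise-shift p a (m + m) ⟩
      (m + m) ! + p * a * rise′ 0 (m + m)                            ≡⟨ cong₂ (λ x y → x + p * a * y) (sym (binomial-factorials m m)) (rise′-+ 0 m m) ⟩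
      B * (M * M) + p * a * (E * rise m m + rise 0 m * rise′ m m)    ≡⟨ expand p a B M E (rise m m) (rise 0 m * rise′ m m) ⟩
      (B * (M * M) + p * a * (E * rise m m)) + p * (a * (rise 0 m * rise′ m m))
        ≈⟨ mod-absorb _ (ℕᵈ.*-monoʳ-∣ p (ℕᵈ.∣n⇒∣m*n a (ℕᵈ.∣n⇒∣m*n (rise 0 m) p∣rise′-upper))) ⟩
      B * (M * M) + p * a * (E * rise m m)                           ≡⟨ cong (λ r → B * (M * M) + p * a * (E * r)) (rise-binomial m m) ⟩
      B * (M * M) + p * a * (E * (B * M))                            ≡⟨ factor p a B M E ⟩
      B * G a                                                        ∎

  congruence : ∀ b c → ((p * b + m) + (p * c + m)) C (p * b + m) ≡ ((b + c) C b) * B [mod p * p ]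
  congruence b c = mod-cancel p-prime (p∤U (b + c)) (begin
    U (b + c) * X                                                           ≡⟨ *-comm (U (b + c)) X ⟩
    X * U (b + c)                                                           ≈⟨ mod-* (mod-refl X) (mod-sym (left≡U b c)) ⟩
    X * (blocks k b * blocks k c * (rise (p * b) m * rise (p * c) m))       ≡⟨ binomial-blocks k b c m m ⟩
    K * (blocks k (b + c) * rise (p * (b + c)) (m + m))                     ≈⟨ mod-* (mod-refl K) (right≡BU (b + c)) ⟩
    K * (B * U (b + c))                                                     ≡⟨ sym (*-assoc K B (U (b + c))) ⟩
    K * B * U (b + c)                                                       ≡⟨ *-comm (K * B) (U (b + c)) ⟩
    U (b + c) * (K * B)                                                     ∎)
    where
    k = 3 * m
    X = ((p * b + m) + (p * c + m)) C (p * b + m)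
    K = (b + c) C b

  theorem : ∀ a b → (p * a + 2 * m) C (p * b + m) ≡ (a C b) * ((2 * m) C m) [mod p * p ]
  theorem a b with b ≤? a
  ... | yes b≤a with m≤n⇒∃[o]m+o≡n b≤a
  ...   | c , refl = subst₂ (λ N T → N C (p * b + m) ≡ ((b + c) C b) * (T C m) [mod p * p ])
                            (interleave p b c m) (sym (2*m≡m+m m)) (congruence b c)
    where
    interleave : ∀ p b c m → (p * b + m) + (p * c + m) ≡ p * (b + c) + 2 * m
    interleave = ℕ-Solver.solve-∀
    2*m≡m+m : ∀ m → 2 * m ≡ m + m
    2*m≡m+m = ℕ-Solver.solve-∀
  theorem a b | no b≰a
    rewrite k>n⇒nCk≡0 (lower-too-large (≰⇒> b≰a)) | k>n⇒nCk≡0 (≰⇒> b≰a) = mod-refl 0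

corollary3 : (p m : ℕ) → Prime p → p ≡ 3 * m + 1 → (a b : ℕ) →
    (+ (p ^ 2)) ∣ (+ ((p * a + 2 * m) C (p * b + m)) - + ((a C b) * ((2 * m) C m)))
corollary3 p m p-prime p≡3m+1 a b with trans p≡3m+1 (+-comm (3 * m) 1)
... | refl = divides (mod-weaken p²∣p*p (Corollary.theorem m p-prime a b))
  where
  p²∣p*p : p ^ 2 ∣ₙ p * p
  p²∣p*p = ℕᵈ.∣-reflexive (cong (p *_) (*-identityʳ p))
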